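{- Let $e$ be an edge in a connected hypergraph $H=(V,E)$. The following are equivalent: (1) $e$ is a strong cut edge, that is, $\omega(H-e)=|e|$; (2) $e$ contains exactly one vertex from each connected component of $H-e$; (3) $e$ lies in no cycle of $H$.
   Context: A hypergraph $H=(V,E)$ consists of a nonempty finite vertex set $V$, a finite edge set $E$, and an incidence function $\psi:E\to 2^V$; edges are identified with their vertex sets (distinct edges may be parallel). Two distinct vertices are adjacent via $e$ if both lie in $e$; a walk is a sequence $v_0e_1v_1\dots e_kv_k$ with $v_{i-1},v_i$ adjacent via $e_i$; $H$ is connected if any two distinct vertices are joined by a walk. For an equivalence class $V'$ of "joined by a walk", the connected component is $(V',\{f\in E:\emptyset\ne f\subseteq V'\})$; $\omega(H)$ is the number of components. $H-e=(V,E\setminus\{e\})$. A cut edge is an edge $e$ with $\omega(H-e)>\omega(H)$; it is strong if $\omega(H-e)=\omega(H)+|e|-1$. A cycle is a walk $v_0e_1v_1\dots e_kv_k$ with $k\ge2$, $v_0=v_k$, the vertices $v_0,\dots,v_{k-1}$ pairwise distinct and the edges $e_1,\dots,e_k$ pairwise distinct; an edge lies in the cycle if it is one of the $e_i$. -}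

module Defs where

open import Data.Nat using (ℕ; zero; suc; pred; _≤_; _<_)
open import Data.Fin using (Fin; zero; suc; punchIn; inject₁; fromℕ)
open import Data.Fin.Subset using (Subset; _∈_; ∣_∣; Nonempty) public
open import Data.Product using (Σ; ∃; ∃!; _×_; _,_)
open import Function.Definitions using (Injective; Surjective)
open import Function.Bundles using (_⇔_)
open import Relation.Nullary using (¬_)
open import Relation.Binary.PropositionalEquality using (_≡_; _≢_)

-- A hypergraph with vertex set V = Fin nV (nonempty) and edge set E = Fin nE;
-- ψ is the incidence function E → 2^V (parallel and empty edges allowed).
record Hypergraph : Set where
  constructor hypergraph
  field
    nV        : ℕ
    nE        : ℕ
    nonemptyV : 0 < nV
    ψ         : Fin nE → Subset nV

open Hypergraph public

Vertex : Hypergraph → Set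
Vertex H = Fin (nV H)

Edge : Hypergraph → Set
Edge H = Fin (nE H)

-- H - e = (V, E \ {e}); the remaining edges are re-indexed by punchIn e.
removeψ : ∀ {m n} → (Fin m → Subset n) → Fin m → Fin (pred m) → Subset n
removeψ {suc m} ψ₀ e f = ψ₀ (punchIn e f)

_-_ : (H : Hypergraph) → Edge H → Hypergraph
H - e = record H { nE = pred (nE H) ; ψ = removeψ (ψ H) e }

Adjacent : (H : Hypergraph) → Edge H → Vertex H → Vertex H → Set
Adjacent H e u v = u ≢ v × u ∈ ψ H e × v ∈ ψ H e

data Walk (H : Hypergraph) : Vertex H → Vertex H → Set where
  []   : ∀ {u} → Walk H u u
  step : ∀ {u v w} (e : Edge H) → Adjacent H e u v → Walk H v w → Walk H u w

Joined : (H : Hypergraph) → Vertex H → Vertex H → Set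
Joined H u v = Walk H u v

Connected : Hypergraph → Set
Connected H = ∀ (u v : Vertex H) → u ≢ v → Joined H u v

-- ω(H) = k : the equivalence classes of "joined by a walk" are exactly k many,
-- witnessed by a surjective class map c whose fibres are the classes.
ω≡ : Hypergraph → ℕ → Set
ω≡ H k = Σ (Vertex H → Fin k) λ c →
           Surjective _≡_ _≡_ c × (∀ u v → (c u ≡ c v) ⇔ Joined H u v)

-- A cycle v₀ e₁ v₁ … e_k v_k (k ≥ 2, v₀ = v_k, v₀…v_{k-1} distinct,
-- e₁…e_k distinct); vertices indexed 0..k, edges 0..k-1
-- (edge i joins vertex i and vertex i+1).
record Cycle (H : Hypergraph) : Set where
  field
    len       : ℕ
    len≥2     : 2 ≤ len
    vert      : Fin (suc len) → Vertex H
    edge      : Fin len → Edge H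
    closed    : vert zero ≡ vert (fromℕ len)
    adj       : ∀ (i : Fin len) → Adjacent H (edge i) (vert (inject₁ i)) (vert (suc i))
    distinctV : ∀ (i j : Fin len) → vert (inject₁ i) ≡ vert (inject₁ j) → i ≡ j
    distinctE : Injective _≡_ _≡_ edge

LiesIn : (H : Hypergraph) → Edge H → Cycle H → Set
LiesIn H e C = ∃ λ i → Cycle.edge C i ≡ e

StrongCut : (H : Hypergraph) → Edge H → Set
StrongCut H e = ω≡ (H - e) ∣ ψ H e ∣

-- (2) every component of H - e contains exactly one vertex of e:
--     for each vertex u there is exactly one v ∈ e joined to u in H - e
OneVertexPerComponent : (H : Hypergraph) → Edge H → Set
OneVertexPerComponent H e =
  ∀ (u : Vertex H) → ∃! _≡_ λ (v : Vertex H) → v ∈ ψ H e × Joined (H - e) u v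

InNoCycle : (H : Hypergraph) → Edge H → Set
InNoCycle H e = (C : Cycle H) → ¬ LiesIn H e C

-- All three conditions are equivalent to: distinct vertices of e lie in
-- distinct components of H - e.  Since H is connected, every component of
-- H - e meets e, so this is (2); and it makes "component of a vertex of e"
-- a bijection between e and the components, which gives (1).  Conversely a
-- surjection onto ω(H - e) = |e| classes that is hit by the vertices of e
-- is injective on them.  For (3): two distinct vertices of e joined in H - e
-- are joined by a path there, which e closes into a cycle; and the rest of a
-- cycle through e joins the two ends of e in H - e.
module Submission where

open import Defs
open import Data.Bool using (true; false)
open import Data.Empty using (⊥-elim)
open import Data.Fin using (Fin; zero; suc; punchIn; punchOut; inject₁; fromℕ; _≟_)
open import Data.Fin.Properties
  using (suc-injective; any?; injective⇒≤; punchIn-injective; punchInᵢ≢i; punchIn-punchOut;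
         punchOut-injective; fromℕ≢inject₁; inject₁-injective)
open import Data.Fin.Subset.Properties using (_∈?_)
open import Data.Nat using (ℕ; zero; suc; z≤n; s≤s)
open import Data.Nat.Properties using (1+n≰n)
open import Data.Product using (Σ; ∃; _×_; _,_; proj₁; proj₂)
open import Data.Vec using (_∷_; here; there)
open import Function using (_∘_)
open import Function.Bundles using (_⇔_; mk⇔; Equivalence)
open import Function.Definitions using (Injective; StrictlySurjective)
open import Relation.Nullary using (yes; no; contradiction)
open import Relation.Binary.PropositionalEquality using (_≡_; _≢_; refl; sym; trans; cong; subst)

position : ∀ {n} {p : Subset n} {x} → x ∈ p → Fin ∣ p ∣
position here                 = zero
position (there {y = true} m)  = suc (position m)
position (there {y = false} m) = position m

element : ∀ {n} (p : Subset n) → Fin ∣ p ∣ → Fin n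
element (true ∷ p)  zero    = zero
element (true ∷ p)  (suc i) = suc (element p i)
element (false ∷ p) i       = suc (element p i)

element-∈ : ∀ {n} (p : Subset n) i → element p i ∈ p
element-∈ (true ∷ p)  zero    = here
element-∈ (true ∷ p)  (suc i) = there (element-∈ p i)
element-∈ (false ∷ p) i       = there (element-∈ p i)

position-element : ∀ {n} (p : Subset n) i → position (element-∈ p i) ≡ i
position-element (true ∷ p)  zero    = refl
position-element (true ∷ p)  (suc i) = cong suc (position-element p i)
position-element (false ∷ p) i       = position-element p i

element-position : ∀ {n} {p : Subset n} {x} (m : x ∈ p) → element p (position m) ≡ x
element-position here                 = refl
element-position (there {y = true} m)  = cong suc (element-position m)
element-position (there {y = false} m) = cong suc (element-position m)

position-injective : ∀ {n} {p : Subset n} {x y} (m : x ∈ p) (m′ : y ∈ p) →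
                     position m ≡ position m′ → x ≡ y
position-injective {p = p} m m′ eq =
  trans (sym (element-position m)) (trans (cong (element p) eq) (element-position m′))

∈-irrelevant : ∀ {n} {p : Subset n} {x} (m m′ : x ∈ p) → m ≡ m′
∈-irrelevant here      here       = refl
∈-irrelevant (there m) (there m′) = cong there (∈-irrelevant m m′)

position-cong : ∀ {n} {p : Subset n} {x y} → x ≡ y → (m : x ∈ p) (m′ : y ∈ p) →
                position m ≡ position m′
position-cong refl m m′ = cong position (∈-irrelevant m m′)

surjective⇒injective : ∀ {n} (f : Fin n → Fin n) → StrictlySurjective _≡_ f → Injective _≡_ _≡_ f
surjective⇒injective {suc n} f surj {a} {b} fa≡fb with a ≟ b
... | yes a≡b = a≡b
... | no a≢b  = contradiction (injective⇒≤ squeezed-injective) 1+n≰n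
  where
  section : Fin (suc n) → Fin (suc n)
  section y = proj₁ (surj y)

  section-injective : Injective _≡_ _≡_ section
  section-injective {y} {z} eq =
    trans (sym (proj₂ (surj y))) (trans (cong f eq) (proj₂ (surj z)))

  -- Of a and b, which share an image, the section can reach at most one.
  missed : Σ (Fin (suc n)) λ c → f c ≡ f a × c ≢ section (f a)
  missed with a ≟ section (f a)
  ... | no a≢  = a , refl , a≢
  ... | yes a≡ = b , sym fa≡fb , λ b≡ → a≢b (trans a≡ (sym b≡))

  c : Fin (suc n)
  c = proj₁ missed

  never-c : ∀ z → c ≢ section z
  never-c z c≡ = proj₂ (proj₂ missed) (subst (λ y → c ≡ section y) z≡fa c≡)
    where
    z≡fa : z ≡ f a
    z≡fa = trans (sym (proj₂ (surj z))) (trans (cong f (sym c≡)) (proj₁ (proj₂ missed)))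

  squeezed-injective : Injective _≡_ _≡_ (λ z → punchOut (never-c z))
  squeezed-injective {y} {z} eq = section-injective (punchOut-injective (never-c y) (never-c z) eq)

module _ {G : Hypergraph} where

  infixr 5 _++_

  _++_ : ∀ {u v w} → Walk G u v → Walk G v w → Walk G u w
  []           ++ q = q
  step f a p   ++ q = step f a (p ++ q)

  reverse : ∀ {u v} → Walk G u v → Walk G v u
  reverse []                           = []
  reverse (step f (u≢v , u∈f , v∈f) p) = reverse p ++ step f (u≢v ∘ sym , v∈f , u∈f) []

  length : ∀ {u v} → Walk G u v → ℕ
  length []           = zero
  length (step f a p) = suc (length p)

  vertexAt : ∀ {u v} (p : Walk G u v) → Fin (suc (length p)) → Vertex G
  vertexAt {u} []           zero    = u
  vertexAt {u} (step f a p) zero    = u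
  vertexAt     (step f a p) (suc i) = vertexAt p i

  edgeAt : ∀ {u v} (p : Walk G u v) → Fin (length p) → Edge G
  edgeAt (step f a p) zero    = f
  edgeAt (step f a p) (suc i) = edgeAt p i

  vertexAt-zero : ∀ {u v} (p : Walk G u v) → vertexAt p zero ≡ u
  vertexAt-zero []           = refl
  vertexAt-zero (step f a p) = refl

  vertexAt-last : ∀ {u v} (p : Walk G u v) → vertexAt p (fromℕ (length p)) ≡ v
  vertexAt-last []           = refl
  vertexAt-last (step f a p) = vertexAt-last p

  adjacentAt : ∀ {u v} (p : Walk G u v) (i : Fin (length p)) →
               Adjacent G (edgeAt p i) (vertexAt p (inject₁ i)) (vertexAt p (suc i))
  adjacentAt (step f a [])           zero    = a
  adjacentAt (step f a (step g b p)) zero    = a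
  adjacentAt (step f a p)            (suc i) = adjacentAt p i

  data IsPath : ∀ {u v} → Walk G u v → Set where
    []   : ∀ {u} → IsPath ([] {u = u})
    step : ∀ {u v w f} {a : Adjacent G f u v} {p : Walk G v w} → IsPath p →
           (∀ i → vertexAt p i ≢ u) → (∀ i → edgeAt p i ≢ f) → IsPath (step f a p)

  Path : Vertex G → Vertex G → Set
  Path u v = Σ (Walk G u v) IsPath

  vertexAt-injective : ∀ {u v} {p : Walk G u v} → IsPath p →
                       ∀ i j → vertexAt p i ≡ vertexAt p j → i ≡ j
  vertexAt-injective _               zero    zero    _  = refl
  vertexAt-injective (step _ new _)  zero    (suc j) eq = ⊥-elim (new j (sym eq))
  vertexAt-injective (step _ new _)  (suc i) zero    eq = ⊥-elim (new i eq)
  vertexAt-injective (step path _ _) (suc i) (suc j) eq = cong suc (vertexAt-injective path i j eq)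

  edgeAt-injective : ∀ {u v} {p : Walk G u v} → IsPath p →
                     ∀ i j → edgeAt p i ≡ edgeAt p j → i ≡ j
  edgeAt-injective (step _ _ _)    zero    zero    _  = refl
  edgeAt-injective (step _ _ new)  zero    (suc j) eq = ⊥-elim (new j (sym eq))
  edgeAt-injective (step _ _ new)  (suc i) zero    eq = ⊥-elim (new i eq)
  edgeAt-injective (step path _ _) (suc i) (suc j) eq = cong suc (edgeAt-injective path i j eq)

  dropPath : ∀ {u v} (p : Walk G u v) → IsPath p → (i : Fin (suc (length p))) → Path (vertexAt p i) v
  dropPath []           path            zero    = [] , path
  dropPath (step f a p) path            zero    = step f a p , path
  dropPath (step f a p) (step path _ _) (suc i) = dropPath p path i

  -- Enter the path at its last vertex lying in f; no later edge can then be f.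
  shortcut : ∀ {u v w} (f : Edge G) → u ∈ ψ G f → (p : Walk G v w) → IsPath p →
             (∀ i → vertexAt p i ≢ u) → (∃ λ i → vertexAt p i ∈ ψ G f) → Path u w
  shortcut f u∈f [] path new (zero , w∈f) =
    step f (new zero ∘ sym , u∈f , w∈f) [] , step path new (λ ())
  shortcut f u∈f p@(step g a q) path@(step q-path _ _) new hit
    with any? (λ i → vertexAt q i ∈? ψ G f)
  ... | yes later = shortcut f u∈f q q-path (new ∘ suc) later
  ... | no ¬later = step f (new zero ∘ sym , u∈f , v∈f hit) p , step path new f-unused
    where
    v∈f : ∃ (λ i → vertexAt p i ∈ ψ G f) → vertexAt p zero ∈ ψ G f
    v∈f (zero  , x∈f) = x∈f
    v∈f (suc i , x∈f) = ⊥-elim (¬later (i , x∈f))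

    f-unused : ∀ i → edgeAt p i ≢ f
    f-unused i refl = ¬later (i , proj₂ (proj₂ (adjacentAt p i)))

  walk⇒path : ∀ {u v} → Walk G u v → Path u v
  walk⇒path []  = [] , []
  walk⇒path {u} (step f (_ , u∈f , x∈f) w) with walk⇒path w
  ... | p , path with any? (λ i → vertexAt p i ≟ u)
  ... | yes (i , refl) = dropPath p path i
  ... | no  u∉p        = shortcut f u∈f p path (λ i eq → u∉p (i , eq))
                           (zero , subst (_∈ ψ G f) (sym (vertexAt-zero p)) x∈f)

walkAlong : ∀ {G n} (v : Fin (suc n) → Vertex G) →
            (∀ j → Walk G (v (inject₁ j)) (v (suc j))) → Walk G (v zero) (v (fromℕ n))
walkAlong {n = zero}  v steps = []
walkAlong {n = suc n} v steps = steps zero ++ walkAlong (v ∘ suc) (steps ∘ suc)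

walkBefore : ∀ {G n} (v : Fin (suc n) → Vertex G) (i : Fin n) →
             (∀ j → j ≢ i → Walk G (v (inject₁ j)) (v (suc j))) → Walk G (v zero) (v (inject₁ i))
walkBefore v zero    steps = []
walkBefore v (suc i) steps =
  steps zero (λ ()) ++ walkBefore (v ∘ suc) i (λ j j≢i → steps (suc j) (j≢i ∘ suc-injective))

walkAfter : ∀ {G n} (v : Fin (suc n) → Vertex G) (i : Fin n) →
            (∀ j → j ≢ i → Walk G (v (inject₁ j)) (v (suc j))) → Walk G (v (suc i)) (v (fromℕ n))
walkAfter v zero    steps = walkAlong (v ∘ suc) (λ j → steps (suc j) (λ ()))
walkAfter v (suc i) steps = walkAfter (v ∘ suc) i (λ j j≢i → steps (suc j) (j≢i ∘ suc-injective))

embedEdge : (H : Hypergraph) (e : Edge H) → Edge (H - e) → Edge H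
embedEdge (hypergraph _ zero    _ _) ()
embedEdge (hypergraph _ (suc _) _ _) e = punchIn e

embedEdge-≢ : (H : Hypergraph) (e : Edge H) (f : Edge (H - e)) → embedEdge H e f ≢ e
embedEdge-≢ (hypergraph _ zero    _ _) ()
embedEdge-≢ (hypergraph _ (suc _) _ _) e f = punchInᵢ≢i e f

embedEdge-injective : (H : Hypergraph) (e : Edge H) → Injective _≡_ _≡_ (embedEdge H e)
embedEdge-injective (hypergraph _ zero    _ _) ()
embedEdge-injective (hypergraph _ (suc _) _ _) e = punchIn-injective e _ _

embedEdge-adjacent : (H : Hypergraph) (e : Edge H) {f : Edge (H - e)} {u v : Vertex H} →
                     Adjacent (H - e) f u v → Adjacent H (embedEdge H e f) u v
embedEdge-adjacent (hypergraph _ zero    _ _) ()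
embedEdge-adjacent (hypergraph _ (suc _) _ _) e a = a

stepAvoiding : (H : Hypergraph) (e : Edge H) {f : Edge H} {u v : Vertex H} →
               f ≢ e → Adjacent H f u v → Walk (H - e) u v
stepAvoiding (hypergraph _ zero _ _) ()
stepAvoiding H@(hypergraph _ (suc _) _ _) e {u = u} {v} f≢e a =
  step _ (subst (λ g → Adjacent H g u v) (sym (punchIn-punchOut (f≢e ∘ sym))) a) []

cycle-joined-around : (H : Hypergraph) (C : Cycle H) (i : Fin (Cycle.len C)) →
                      Joined (H - Cycle.edge C i) (Cycle.vert C (suc i)) (Cycle.vert C (inject₁ i))
cycle-joined-around H C i =
  walkAfter vert i steps ++ subst (λ x → Walk _ x (vert (inject₁ i))) closed (walkBefore vert i steps)
  where
  open Cycle C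

  steps : ∀ j → j ≢ i → Walk (H - edge i) (vert (inject₁ j)) (vert (suc j))
  steps j j≢i = stepAvoiding H (edge i) (j≢i ∘ distinctE) (adj j)

module _ (H : Hypergraph) (e : Edge H) where

  Representative : Vertex H → Vertex H → Set
  Representative u v = v ∈ ψ H e × Joined (H - e) u v

  Separated : Set
  Separated = ∀ {v w} → v ∈ ψ H e → w ∈ ψ H e → Joined (H - e) v w → v ≡ w

  walk⇒representative : ∀ {u x} → Walk H u x → x ∈ ψ H e → ∃ (Representative u)
  walk⇒representative [] x∈e = _ , x∈e , []
  walk⇒representative (step f a w) x∈e with f ≟ e
  ... | yes refl = _ , proj₁ (proj₂ a) , []
  ... | no f≢e with walk⇒representative w x∈e
  ...   | v , v∈e , joined = v , v∈e , stepAvoiding H e f≢e a ++ joined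

  connected⇒representative : Connected H → Nonempty (ψ H e) → ∀ u → ∃ (Representative u)
  connected⇒representative conn (x , x∈e) u with u ≟ x
  ... | yes refl = u , x∈e , []
  ... | no u≢x   = walk⇒representative (conn u x u≢x) x∈e

  separated⇒oneVertexPerComponent : Connected H → Nonempty (ψ H e) → Separated →
                                    OneVertexPerComponent H e
  separated⇒oneVertexPerComponent conn nonempty separated u
    with connected⇒representative conn nonempty u
  ... | v , v∈e , joined =
    v , (v∈e , joined) , λ (w∈e , joined′) → separated v∈e w∈e (reverse joined ++ joined′)

  oneVertexPerComponent⇒separated : OneVertexPerComponent H e → Separated
  oneVertexPerComponent⇒separated unique {v} {w} v∈e w∈e joined =
    trans (sym (proj₂ (proj₂ (unique v)) (v∈e , []))) (proj₂ (proj₂ (unique v)) (w∈e , joined))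

  strongCut⇒separated : Connected H → Nonempty (ψ H e) → StrongCut H e → Separated
  strongCut⇒separated conn nonempty (c , c-surjective , c-classes) v∈e w∈e joined =
    position-injective v∈e w∈e
      (surjective⇒injective c∘element c∘element-surjective (c-position v∈e w∈e joined))
    where
    c∘element : Fin ∣ ψ H e ∣ → Fin ∣ ψ H e ∣
    c∘element i = c (element (ψ H e) i)

    c-position : ∀ {x y} (x∈e : x ∈ ψ H e) (y∈e : y ∈ ψ H e) → Joined (H - e) x y →
                 c∘element (position x∈e) ≡ c∘element (position y∈e)
    c-position {x} {y} x∈e y∈e x~y =
      trans (cong c (element-position x∈e))
            (trans (Equivalence.from (c-classes x y) x~y) (cong c (sym (element-position y∈e))))

    c∘element-surjective : StrictlySurjective _≡_ c∘element
    c∘element-surjective j with c-surjective j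
    ... | u , cu≡j with connected⇒representative conn nonempty u
    ...   | w , w∈e , u~w =
      position w∈e ,
      trans (cong c (element-position w∈e)) (trans (Equivalence.from (c-classes w u) (reverse u~w)) (cu≡j refl))

  oneVertexPerComponent⇒strongCut : OneVertexPerComponent H e → StrongCut H e
  oneVertexPerComponent⇒strongCut unique = c , c-surjective , c-classes
    where
    rep : Vertex H → Vertex H
    rep u = proj₁ (unique u)

    rep-∈ : ∀ u → rep u ∈ ψ H e
    rep-∈ u = proj₁ (proj₁ (proj₂ (unique u)))

    rep-joined : ∀ u → Joined (H - e) u (rep u)
    rep-joined u = proj₂ (proj₁ (proj₂ (unique u)))

    rep-unique : ∀ {u v} → Representative u v → rep u ≡ v
    rep-unique {u} = proj₂ (proj₂ (unique u))

    c : Vertex H → Fin ∣ ψ H e ∣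
    c u = position (rep-∈ u)

    c-surjective : ∀ i → ∃ λ x → ∀ {z} → z ≡ x → c z ≡ i
    c-surjective i = element (ψ H e) i , λ { refl →
      trans (position-cong (rep-unique (element-∈ (ψ H e) i , [])) (rep-∈ _) (element-∈ (ψ H e) i))
            (position-element (ψ H e) i) }

    c-classes : ∀ u v → (c u ≡ c v) ⇔ Joined (H - e) u v
    c-classes u v = mk⇔ to from
      where
      to : c u ≡ c v → Joined (H - e) u v
      to eq = rep-joined u ++ subst (λ x → Joined (H - e) x v)
                                    (sym (position-injective (rep-∈ u) (rep-∈ v) eq)) (reverse (rep-joined v))

      from : Joined (H - e) u v → c u ≡ c v
      from u~v = position-cong (rep-unique (rep-∈ v , u~v ++ rep-joined v)) (rep-∈ u) (rep-∈ v)

  separated⇒inNoCycle : Separated → InNoCycle H e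
  separated⇒inNoCycle separated C (i , refl) = u≢v (sym (separated v∈e u∈e (cycle-joined-around H C i)))
    where
    open Cycle C using (adj)
    u≢v = proj₁ (adj i)
    u∈e = proj₁ (proj₂ (adj i))
    v∈e = proj₂ (proj₂ (adj i))

  closePath : ∀ {v w} → v ≢ w → v ∈ ψ H e → w ∈ ψ H e →
              (p : Walk (H - e) w v) → IsPath p → Σ (Cycle H) (LiesIn H e)
  closePath v≢w v∈e w∈e []               _    = ⊥-elim (v≢w refl)
  closePath {v} v≢w v∈e w∈e p@(step _ _ _) path = cycle , zero , refl
    where
    vert : Fin (suc (suc (length p))) → Vertex H
    vert zero    = v
    vert (suc i) = vertexAt p i

    edge : Fin (suc (length p)) → Edge H
    edge zero    = e
    edge (suc i) = embedEdge H e (edgeAt p i)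

    adj : ∀ i → Adjacent H (edge i) (vert (inject₁ i)) (vert (suc i))
    adj zero    = v≢w , v∈e , w∈e
    adj (suc i) = embedEdge-adjacent H e (adjacentAt p i)

    v-not-inner : ∀ j → v ≢ vertexAt p (inject₁ j)
    v-not-inner j eq =
      fromℕ≢inject₁ (vertexAt-injective path _ (inject₁ j) (trans (vertexAt-last p) eq))

    distinctV : ∀ i j → vert (inject₁ i) ≡ vert (inject₁ j) → i ≡ j
    distinctV zero    zero    _  = refl
    distinctV zero    (suc j) eq = ⊥-elim (v-not-inner j eq)
    distinctV (suc i) zero    eq = ⊥-elim (v-not-inner i (sym eq))
    distinctV (suc i) (suc j) eq = cong suc (inject₁-injective (vertexAt-injective path _ _ eq))

    distinctE : Injective _≡_ _≡_ edge
    distinctE {zero}  {zero}  _  = refl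
    distinctE {zero}  {suc j} eq = ⊥-elim (embedEdge-≢ H e _ (sym eq))
    distinctE {suc i} {zero}  eq = ⊥-elim (embedEdge-≢ H e _ eq)
    distinctE {suc i} {suc j} eq = cong suc (edgeAt-injective path _ _ (embedEdge-injective H e eq))

    cycle : Cycle H
    cycle = record
      { len = suc (length p) ; len≥2 = s≤s (s≤s z≤n) ; vert = vert ; edge = edge
      ; closed = sym (vertexAt-last p) ; adj = adj ; distinctV = distinctV ; distinctE = distinctE }

  inNoCycle⇒separated : InNoCycle H e → Separated
  inNoCycle⇒separated noCycle {v} {w} v∈e w∈e joined with v ≟ w
  ... | yes v≡w = v≡w
  ... | no v≢w with walk⇒path (reverse joined)
  ...   | p , path with closePath v≢w v∈e w∈e p path
  ...     | C , e∈C = ⊥-elim (noCycle C e∈C)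

theorem3p18 : (H : Hypergraph) → Connected H → (e : Edge H) → Nonempty (ψ H e) →
                (StrongCut H e ⇔ OneVertexPerComponent H e)
                  × (OneVertexPerComponent H e ⇔ InNoCycle H e)
theorem3p18 H conn e nonempty =
  mk⇔ (fromSeparated ∘ strongCut⇒separated H e conn nonempty) (oneVertexPerComponent⇒strongCut H e) ,
  mk⇔ (separated⇒inNoCycle H e ∘ oneVertexPerComponent⇒separated H e)
      (fromSeparated ∘ inNoCycle⇒separated H e)
  where
  fromSeparated : Separated H e → OneVertexPerComponent H e
  fromSeparated = separated⇒oneVertexPerComponent H e conn nonempty
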